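{- Let $n,r\ge1$ and $\mathbf u=(n,\dots,n)\in\mathbb{N}_{>0}^r$. Then the additive self-maps of $E_{\mathbf u}$ are exactly the maps $L(x_1,\dots,x_r)=(x_{\varphi(1)},\dots,x_{\varphi(r)})$ where $\varphi:\{1,\dots,r\}\to\{0,1,\dots,r\}$ is arbitrary and $x_0:=0$. Consequently $\#\{M\in M_r(\mathbb{N}):M\mathbf u\le\mathbf u\}=(r+1)^r$, and the number of binary operations on $E_{\mathbf u}$ satisfying (S1) and (S2) is $\bigl((r+1)^r\bigr)^{(n+1)^r-1}$.
   Context: For $\mathbf u\in\mathbb{N}_{>0}^r$, $E_{\mathbf u}=\{x\in\mathbb{Z}_{\ge0}^r:0\le x\le\mathbf u\}$ is the effect algebra with partial addition $x\oplus y=x+y$ defined (written $x\perp y$) iff $x+y\le\mathbf u$, top $\mathbf u$; for $\mathbf u=(n,\dots,n)$ it is the $r$-fold power of the $(n+1)$-element chain. A map $L$ is additive if $x\perp y$ implies $L(x\oplus y)=L(x)\oplus L(y)$. Axioms for a total binary operation $\circ$: (S1) each left translation $x\mapsto a\circ x$ is additive; (S2) $\mathbf u\circ a=a$. -}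

module Defs where

open import Data.Nat using (ℕ; zero; suc; _+_; _*_; _≤_)
open import Data.Fin using (Fin; zero; suc)
open import Data.Vec using (Vec; []; _∷_; lookup; tabulate; replicate; zipWith; map)
open import Data.Vec.Relation.Binary.Pointwise.Inductive using (Pointwise)
open import Data.List using (List)
open import Data.Product using (_×_; ∃)
open import Relation.Binary.PropositionalEquality using (_≡_)

_≤ᵥ_ : ∀ {r} → Vec ℕ r → Vec ℕ r → Set
_≤ᵥ_ = Pointwise _≤_

_+ᵥ_ : ∀ {r} → Vec ℕ r → Vec ℕ r → Vec ℕ r
_+ᵥ_ = zipWith _+_

uvec : (r n : ℕ) → Vec ℕ r
uvec r n = replicate r n

InE : ∀ {r} → Vec ℕ r → Vec ℕ r → Set
InE u x = x ≤ᵥ u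

-- x ⊥ y  iff  x + y ≤ u  (for x, y ∈ E_u); then x ⊕ y = x + y
Orth : ∀ {r} → Vec ℕ r → Vec ℕ r → Vec ℕ r → Set
Orth u x y = (x +ᵥ y) ≤ᵥ u

-- L is an additive self-map of E_u: it maps E_u into E_u and
-- x ⊥ y implies L (x ⊕ y) = L x ⊕ L y  (only the values on E_u matter)
IsAdditiveSelfMap : ∀ {r} → Vec ℕ r → (Vec ℕ r → Vec ℕ r) → Set
IsAdditiveSelfMap u L =
  (∀ x → InE u x → InE u (L x)) ×
  (∀ x y → InE u x → InE u y → Orth u x y → L (x +ᵥ y) ≡ L x +ᵥ L y)

ext : ∀ {r} → Vec ℕ r → Fin (suc r) → ℕ
ext x zero = 0
ext x (suc j) = lookup x j

selectMap : ∀ {r} → (Fin r → Fin (suc r)) → Vec ℕ r → Vec ℕ r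
selectMap φ x = tabulate (λ i → ext x (φ i))

-- r×r matrices over ℕ (list of rows) acting on column vectors
Matrix : ℕ → Set
Matrix r = Vec (Vec ℕ r) r

sumV : ∀ {k} → Vec ℕ k → ℕ
sumV [] = 0
sumV (a ∷ v) = a + sumV v

_*ᴹ_ : ∀ {r} → Matrix r → Vec ℕ r → Vec ℕ r
M *ᴹ v = map (λ row → sumV (zipWith _*_ row v)) M

-- Binary operations on E_u, represented on ℕ^r; only values on E_u × E_u matter
BinOp : ℕ → Set
BinOp r = Vec ℕ r → Vec ℕ r → Vec ℕ r

IsS1S2 : ∀ {r} → Vec ℕ r → BinOp r → Set
IsS1S2 u op =
  (∀ a x → InE u a → InE u x → InE u (op a x)) ×
  (∀ a → InE u a → IsAdditiveSelfMap u (λ x → op a x)) ×    -- (S1)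
  (∀ a → InE u a → op u a ≡ a)                              -- (S2)

SameOp : ∀ {r} → Vec ℕ r → BinOp r → BinOp r → Set
SameOp u op op' = ∀ a x → InE u a → InE u x → op a x ≡ op' a x

-- "the set {a : A | P a}, with elements identified up to ≈, has exactly N elements":
-- a bijection between Fin N and that set (modulo ≈)
record HasCard {A : Set} (_≈_ : A → A → Set) (P : A → Set) (N : ℕ) : Set where
  field
    enum      : Fin N → A
    enum-P    : ∀ i → P (enum i)
    enum-inj  : ∀ i j → enum i ≈ enum j → i ≡ j
    enum-surj : ∀ a → P a → ∃ λ i → enum i ≈ a

{-# OPTIONS --safe #-}
module Submission where

-- An additive functional f on E_u is linear on E_u: splitting off one coordinate
-- at a time, f x = Σ w_j x_j with w_j = f(e_j).  For u = (n,…,n) the bound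
-- f u = n Σ w_j ≤ n forces Σ w_j ≤ 1, so w is zero or a unit row and f is 0 or a
-- coordinate x_j; applied to every coordinate of an additive L this gives the
-- selection maps.  The same bound shows that the rows of an M with M u ≤ u are
-- zero or unit rows, so there are (r+1)^r such matrices.  Finally, (S2) fixes the
-- left translation by u, while by (S1) the translation by each of the other
-- (n+1)^r − 1 elements of E_u is an arbitrary selection map.

open import Defs
open import Data.Nat using (ℕ; zero; suc; _+_; _*_; _≤_; _^_; _∸_; z≤n; s≤s; >-nonZero)
open import Data.Nat.Properties
  using (_≟_; ≤-refl; ≤-trans; <⇒≤; +-identityˡ; +-identityʳ; +-cancelˡ-≡; *-comm; *-zeroʳ; *-identityˡ;
         *-distribʳ-+; *-cancelʳ-≤)
open import Data.Fin using (Fin; zero; suc; toℕ; fromℕ<; punchIn; punchOut)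
open import Data.Fin.Properties
  using (¬Fin0; *↔×; toℕ-injective; toℕ≤pred[n]; toℕ-fromℕ<; punchIn-injective; punchInᵢ≢i;
         punchIn-punchOut; any?)
open import Data.Vec using (Vec; []; _∷_; lookup; tabulate; replicate; zipWith; map)
open import Data.Vec.Properties
  using (∷-injective; lookup-zipWith; lookup-replicate; lookup∘tabulate; tabulate∘lookup; tabulate-cong;
         zipWith-identityˡ; ≡-dec)
open import Data.Vec.Relation.Binary.Pointwise.Inductive using ([]; _∷_)
import Data.Vec.Relation.Binary.Pointwise.Inductive as Pointwise
open import Data.Product using (_×_; _,_; ∃; proj₁; proj₂; uncurry)
open import Data.Product.Function.NonDependent.Propositional using (_×-↔_)
open import Data.Sum using (_⊎_; inj₁; inj₂)
open import Data.Empty using (⊥-elim)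
open import Function using (_∘_; _↔_; Inverse; mk↔ₛ′)
open import Function.Properties.Inverse using (↔-refl; ↔-trans)
open import Relation.Nullary using (yes; no)
open import Relation.Binary.PropositionalEquality
  using (_≡_; _≢_; refl; sym; trans; cong; cong₂; subst; subst₂; module ≡-Reasoning)

open ≡-Reasoning

≡-from-lookup : ∀ {A : Set} {k} {v w : Vec A k} → (∀ i → lookup v i ≡ lookup w i) → v ≡ w
≡-from-lookup {v = v} {w} eq =
  trans (sym (tabulate∘lookup v)) (trans (tabulate-cong eq) (tabulate∘lookup w))

zipWith-tabulate : ∀ {A B C : Set} {k} (f : A → B → C) (g : Fin k → A) (h : Fin k → B) →
                   zipWith f (tabulate g) (tabulate h) ≡ tabulate (λ i → f (g i) (h i))
zipWith-tabulate {k = zero}  f g h = refl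
zipWith-tabulate {k = suc k} f g h =
  cong (f (g zero) (h zero) ∷_) (zipWith-tabulate f (g ∘ suc) (h ∘ suc))

map-injective : ∀ {A B : Set} {k} {f : A → B} → (∀ {a b} → f a ≡ f b → a ≡ b) →
                {xs ys : Vec A k} → map f xs ≡ map f ys → xs ≡ ys
map-injective f-inj {[]}     {[]}     _  = refl
map-injective f-inj {x ∷ xs} {y ∷ ys} eq =
  cong₂ _∷_ (f-inj (proj₁ (∷-injective eq))) (map-injective f-inj (proj₂ (∷-injective eq)))

+ᵥ-identityˡ : ∀ {k} (x : Vec ℕ k) → replicate k 0 +ᵥ x ≡ x
+ᵥ-identityˡ = zipWith-identityˡ +-identityˡ

≤ᵥ-refl : ∀ {k} {x : Vec ℕ k} → x ≤ᵥ x
≤ᵥ-refl = Pointwise.refl ≤-refl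

0ᵥ≤ᵥ : ∀ {k} (u : Vec ℕ k) → replicate k 0 ≤ᵥ u
0ᵥ≤ᵥ []      = []
0ᵥ≤ᵥ (_ ∷ u) = z≤n ∷ 0ᵥ≤ᵥ u

≤ᵥ-replicate⁺ : ∀ {k n} {x : Vec ℕ k} → (∀ i → lookup x i ≤ n) → x ≤ᵥ replicate k n
≤ᵥ-replicate⁺ {x = []}    _ = []
≤ᵥ-replicate⁺ {x = _ ∷ _} h = h zero ∷ ≤ᵥ-replicate⁺ (h ∘ suc)

≤ᵥ-replicate⁻ : ∀ {k n} {x : Vec ℕ k} → x ≤ᵥ replicate k n → ∀ i → lookup x i ≤ n
≤ᵥ-replicate⁻ {n = n} x≤u i = subst (_ ≤_) (lookup-replicate i n) (Pointwise.lookup x≤u i)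

ext-≤ : ∀ {r n} {x : Vec ℕ r} → x ≤ᵥ replicate r n → ∀ c → ext x c ≤ n
ext-≤ _   zero    = z≤n
ext-≤ x≤u (suc j) = ≤ᵥ-replicate⁻ x≤u j

ext-+ᵥ : ∀ {r} (x y : Vec ℕ r) c → ext (x +ᵥ y) c ≡ ext x c + ext y c
ext-+ᵥ x y zero    = refl
ext-+ᵥ x y (suc j) = lookup-zipWith _+_ j x y

dot : ∀ {k} → Vec ℕ k → Vec ℕ k → ℕ
dot w x = sumV (zipWith _*_ w x)

dot-zeroˡ : ∀ {k} (x : Vec ℕ k) → dot (replicate k 0) x ≡ 0
dot-zeroˡ []      = refl
dot-zeroˡ (_ ∷ x) = dot-zeroˡ x

dot-replicateʳ : ∀ {k} (w : Vec ℕ k) c → dot w (replicate k c) ≡ sumV w * c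
dot-replicateʳ []      c = refl
dot-replicateʳ (a ∷ w) c =
  trans (cong (a * c +_) (dot-replicateʳ w c)) (sym (*-distribʳ-+ c a (sumV w)))

unitVec : ∀ {k} → Fin k → Vec ℕ k
unitVec zero    = 1 ∷ replicate _ 0
unitVec (suc j) = 0 ∷ unitVec j

dot-unitVec : ∀ {k} (j : Fin k) x → dot (unitVec j) x ≡ lookup x j
dot-unitVec zero    (a ∷ x) = trans (cong₂ _+_ (*-identityˡ a) (dot-zeroˡ x)) (+-identityʳ a)
dot-unitVec (suc j) (_ ∷ x) = dot-unitVec j x

lookup-unitVec-diag : ∀ {k} (j : Fin k) → lookup (unitVec j) j ≡ 1
lookup-unitVec-diag zero    = refl
lookup-unitVec-diag (suc j) = lookup-unitVec-diag j

lookup-unitVec≡1 : ∀ {k} (i j : Fin k) → lookup (unitVec i) j ≡ 1 → i ≡ j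
lookup-unitVec≡1 zero    zero    _  = refl
lookup-unitVec≡1 zero    (suc j) eq with () ← trans (sym (lookup-replicate j 0)) eq
lookup-unitVec≡1 (suc i) (suc j) eq = cong suc (lookup-unitVec≡1 i j eq)

unitVec-≤ᵥ : ∀ {k n} → 1 ≤ n → (j : Fin k) → unitVec j ≤ᵥ replicate k n
unitVec-≤ᵥ 1≤n zero    = 1≤n ∷ 0ᵥ≤ᵥ _
unitVec-≤ᵥ 1≤n (suc j) = z≤n ∷ unitVec-≤ᵥ 1≤n j

selectRow : ∀ {r} → Fin (suc r) → Vec ℕ r
selectRow zero    = replicate _ 0
selectRow (suc j) = unitVec j

dot-selectRow : ∀ {r} (c : Fin (suc r)) x → dot (selectRow c) x ≡ ext x c
dot-selectRow zero    x = dot-zeroˡ x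
dot-selectRow (suc j) x = dot-unitVec j x

sumV≤0⇒≡0ᵥ : ∀ {k} (w : Vec ℕ k) → sumV w ≤ 0 → replicate k 0 ≡ w
sumV≤0⇒≡0ᵥ []      _ = refl
sumV≤0⇒≡0ᵥ (0 ∷ w) p = cong (0 ∷_) (sumV≤0⇒≡0ᵥ w p)

sumV≤1⇒selectRow : ∀ {r} (w : Vec ℕ r) → sumV w ≤ 1 → ∃ λ c → selectRow c ≡ w
sumV≤1⇒selectRow [] _ = zero , refl
sumV≤1⇒selectRow (0 ∷ w) s≤1 with sumV≤1⇒selectRow w s≤1
... | zero  , refl = zero , refl
... | suc j , refl = suc (suc j) , refl
sumV≤1⇒selectRow (1 ∷ w) (s≤s s≤0) = suc zero , cong (1 ∷_) (sumV≤0⇒≡0ᵥ w s≤0)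
sumV≤1⇒selectRow (suc (suc _) ∷ _) (s≤s ())

dot-replicate≤⇒selectRow : ∀ {r n} → 1 ≤ n → (w : Vec ℕ r) → dot w (replicate r n) ≤ n →
                            ∃ λ c → selectRow c ≡ w
dot-replicate≤⇒selectRow {n = n} 1≤n w wu≤n = sumV≤1⇒selectRow w
  (*-cancelʳ-≤ (sumV w) 1 n {{>-nonZero 1≤n}}
    (subst₂ _≤_ (dot-replicateʳ w n) (sym (*-identityˡ n)) wu≤n))

ext-separates : ∀ {r n} → 1 ≤ n → {c d : Fin (suc r)} →
                (∀ x → x ≤ᵥ replicate r n → ext x c ≡ ext x d) → c ≡ d
ext-separates _   {zero}  {zero}  _    = refl
ext-separates 1≤n {zero}  {suc j} same
  with () ← trans (same (unitVec j) (unitVec-≤ᵥ 1≤n j)) (lookup-unitVec-diag j)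
ext-separates 1≤n {suc i} {zero}  same
  with () ← trans (sym (same (unitVec i) (unitVec-≤ᵥ 1≤n i))) (lookup-unitVec-diag i)
ext-separates 1≤n {suc i} {suc j} same =
  cong suc (lookup-unitVec≡1 i j
    (trans (sym (same (unitVec i) (unitVec-≤ᵥ 1≤n i))) (lookup-unitVec-diag i)))

selectRow-injective : ∀ {r} {c d : Fin (suc r)} → selectRow c ≡ selectRow d → c ≡ d
selectRow-injective {c = c} {d} eq = ext-separates {n = 1} ≤-refl λ x _ → begin
  ext x c                ≡⟨ sym (dot-selectRow c x) ⟩
  dot (selectRow c) x    ≡⟨ cong (λ w → dot w x) eq ⟩
  dot (selectRow d) x    ≡⟨ dot-selectRow d x ⟩
  ext x d                ∎

selectMap-cong : ∀ {r} {φ ψ : Fin r → Fin (suc r)} → (∀ i → φ i ≡ ψ i) →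
                 ∀ x → selectMap φ x ≡ selectMap ψ x
selectMap-cong φ≗ψ x = tabulate-cong (cong (ext x) ∘ φ≗ψ)

selectMap-+ᵥ : ∀ {r} (φ : Fin r → Fin (suc r)) x y →
               selectMap φ (x +ᵥ y) ≡ selectMap φ x +ᵥ selectMap φ y
selectMap-+ᵥ φ x y = trans (tabulate-cong (ext-+ᵥ x y ∘ φ)) (sym (zipWith-tabulate _+_ _ _))

selectMap-injective : ∀ {r n} → 1 ≤ n → {φ ψ : Fin r → Fin (suc r)} →
                      (∀ x → InE (uvec r n) x → selectMap φ x ≡ selectMap ψ x) → ∀ i → φ i ≡ ψ i
selectMap-injective 1≤n {φ} {ψ} same i = ext-separates 1≤n λ x x≤u → begin
  ext x (φ i)                    ≡⟨ sym (lookup∘tabulate _ i) ⟩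
  lookup (selectMap φ x) i       ≡⟨ cong (λ v → lookup v i) (same x x≤u) ⟩
  lookup (selectMap ψ x) i       ≡⟨ lookup∘tabulate _ i ⟩
  ext x (ψ i)                    ∎

IsAdditiveSelfMap-resp : ∀ {r} {u : Vec ℕ r} {L L′ : Vec ℕ r → Vec ℕ r} →
                         (∀ x → L x ≡ L′ x) → IsAdditiveSelfMap u L′ → IsAdditiveSelfMap u L
IsAdditiveSelfMap-resp {u = u} L≗L′ (L′-E , L′-add) =
  (λ x x≤u → subst (_≤ᵥ u) (sym (L≗L′ x)) (L′-E x x≤u)) ,
  (λ x y x≤u y≤u xy≤u →
    trans (L≗L′ _) (trans (L′-add x y x≤u y≤u xy≤u) (sym (cong₂ _+ᵥ_ (L≗L′ x) (L≗L′ y)))))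

selectMap-isAdditive : ∀ {r n} (φ : Fin r → Fin (suc r)) → IsAdditiveSelfMap (uvec r n) (selectMap φ)
selectMap-isAdditive {n = n} φ =
  (λ x x≤u → ≤ᵥ-replicate⁺ λ i → subst (_≤ n) (sym (lookup∘tabulate _ i)) (ext-≤ x≤u (φ i))) ,
  (λ x y _ _ _ → selectMap-+ᵥ φ x y)

IsAdditiveOn : ∀ {r} → Vec ℕ r → (Vec ℕ r → ℕ) → Set
IsAdditiveOn u f = ∀ x y → InE u x → InE u y → Orth u x y → f (x +ᵥ y) ≡ f x + f y

additive⇒linear : ∀ {r} (u : Vec ℕ r) {f : Vec ℕ r → ℕ} → IsAdditiveOn u f →
                  ∃ λ w → ∀ x → InE u x → f x ≡ dot w x
additive⇒linear [] {f} add =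
  [] , λ { [] [] → sym (+-cancelˡ-≡ (f []) 0 (f []) (trans (+-identityʳ (f [])) (add [] [] [] [] []))) }
additive⇒linear (b ∷ u) {f} add = f e₁ ∷ w , linear
  where
  0ᵥ : Vec ℕ _
  0ᵥ = replicate _ 0

  e₁ : Vec ℕ _
  e₁ = 1 ∷ 0ᵥ

  add′ : ∀ {x y z} → x +ᵥ y ≡ z → InE (b ∷ u) x → InE (b ∷ u) y → InE (b ∷ u) z → f z ≡ f x + f y
  add′ refl = add _ _

  tail-add : IsAdditiveOn u (λ x → f (0 ∷ x))
  tail-add x y x≤u y≤u xy≤u = add (0 ∷ x) (0 ∷ y) (z≤n ∷ x≤u) (z≤n ∷ y≤u) (z≤n ∷ xy≤u)

  w : Vec ℕ _
  w = proj₁ (additive⇒linear u tail-add)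

  tail-linear : ∀ x → InE u x → f (0 ∷ x) ≡ dot w x
  tail-linear = proj₂ (additive⇒linear u tail-add)

  head-linear : ∀ a → a ≤ b → f (a ∷ 0ᵥ) ≡ a * f e₁
  head-linear zero _ = trans (tail-linear 0ᵥ (0ᵥ≤ᵥ u)) (trans (dot-replicateʳ w 0) (*-zeroʳ (sumV w)))
  head-linear (suc a) a<b = begin
    f (suc a ∷ 0ᵥ)          ≡⟨ add′ (cong (suc a ∷_) (+ᵥ-identityˡ 0ᵥ))
                                    (≤-trans (s≤s z≤n) a<b ∷ 0ᵥ≤ᵥ u) (<⇒≤ a<b ∷ 0ᵥ≤ᵥ u) (a<b ∷ 0ᵥ≤ᵥ u) ⟩
    f e₁ + f (a ∷ 0ᵥ)       ≡⟨ cong (f e₁ +_) (head-linear a (<⇒≤ a<b)) ⟩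
    f e₁ + a * f e₁         ∎

  linear : ∀ x → InE (b ∷ u) x → f x ≡ dot (f e₁ ∷ w) x
  linear (a ∷ x) (a≤b ∷ x≤u) = begin
    f (a ∷ x)               ≡⟨ add′ (cong₂ _∷_ (+-identityʳ a) (+ᵥ-identityˡ x))
                                    (a≤b ∷ 0ᵥ≤ᵥ u) (z≤n ∷ x≤u) (a≤b ∷ x≤u) ⟩
    f (a ∷ 0ᵥ) + f (0 ∷ x)  ≡⟨ cong₂ _+_ (head-linear a a≤b) (tail-linear x x≤u) ⟩
    a * f e₁ + dot w x      ≡⟨ cong (_+ dot w x) (*-comm a (f e₁)) ⟩
    f e₁ * a + dot w x      ∎

additive⇒ext : ∀ {r n} {f : Vec ℕ r → ℕ} → 1 ≤ n → IsAdditiveOn (uvec r n) f → f (uvec r n) ≤ n →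
               ∃ λ c → ∀ x → InE (uvec r n) x → f x ≡ ext x c
additive⇒ext {r} {n} {f} 1≤n add fu≤n with additive⇒linear (uvec r n) add
... | w , f≡dot with dot-replicate≤⇒selectRow 1≤n w (subst (_≤ n) (f≡dot _ ≤ᵥ-refl) fu≤n)
... | c , refl = c , λ x x≤u → trans (f≡dot x x≤u) (dot-selectRow c x)

additive⇒selectMap : ∀ {r n} {L : Vec ℕ r → Vec ℕ r} → 1 ≤ n → IsAdditiveSelfMap (uvec r n) L →
                     ∃ λ φ → ∀ x → InE (uvec r n) x → L x ≡ selectMap φ x
additive⇒selectMap {r} {n} {L} 1≤n (L-E , L-add) =
  φ , λ x x≤u → ≡-from-lookup λ i → trans (proj₂ (coordinate i) x x≤u) (sym (lookup∘tabulate _ i))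
  where
  coordinate : ∀ i → ∃ λ c → ∀ x → InE (uvec r n) x → lookup (L x) i ≡ ext x c
  coordinate i = additive⇒ext 1≤n
    (λ x y x≤u y≤u xy≤u →
      trans (cong (λ v → lookup v i) (L-add x y x≤u y≤u xy≤u)) (lookup-zipWith _+_ i (L x) (L y)))
    (≤ᵥ-replicate⁻ (L-E _ ≤ᵥ-refl) i)

  φ : Fin r → Fin (suc r)
  φ i = proj₁ (coordinate i)

^↔Vec : ∀ {m} {A : Set} → Fin m ↔ A → ∀ k → Fin (m ^ k) ↔ Vec A k
^↔Vec e zero    = mk↔ₛ′ (λ _ → []) (λ _ → zero) (λ { [] → refl }) (λ { zero → refl })
^↔Vec {A = A} e (suc k) = ↔-trans *↔× (↔-trans (e ×-↔ ^↔Vec e k) ×↔∷)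
  where
  ×↔∷ : (A × Vec A k) ↔ Vec A (suc k)
  ×↔∷ = mk↔ₛ′ (uncurry _∷_) (λ { (x ∷ xs) → x , xs }) (λ { (x ∷ xs) → refl }) (λ _ → refl)

HasCard-image : ∀ {A B : Set} {_≈_ : A → A → Set} {P : A → Set} {N} → Fin N ↔ B → (f : B → A) →
                (∀ b → P (f b)) → (∀ b c → f b ≈ f c → b ≡ c) → (∀ a → P a → ∃ λ b → f b ≈ a) →
                HasCard _≈_ P N
HasCard-image {_≈_ = _≈_} e f f-P f-inj f-surj = record
  { enum      = f ∘ to
  ; enum-P    = f-P ∘ to
  ; enum-inj  = λ i j fi≈fj →
      trans (sym (strictlyInverseʳ i)) (trans (cong from (f-inj _ _ fi≈fj)) (strictlyInverseʳ j))
  ; enum-surj = λ a Pa →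
      from (proj₁ (f-surj a Pa)) ,
      subst (λ b → f b ≈ a) (sym (strictlyInverseˡ _)) (proj₂ (f-surj a Pa))
  }
  where open Inverse e

HasCard-remove : ∀ {A : Set} {P : A → Set} {N} (a₀ : A) → P a₀ → HasCard _≡_ P N →
                 HasCard _≡_ (λ a → P a × a ≢ a₀) (N ∸ 1)
HasCard-remove {N = zero}  a₀ Pa₀ card = ⊥-elim (¬Fin0 (proj₁ (HasCard.enum-surj card a₀ Pa₀)))
HasCard-remove {N = suc K} a₀ Pa₀ card = record
  { enum      = enum ∘ punchIn i₀
  ; enum-P    = λ j → enum-P (punchIn i₀ j) ,
                      λ eq → punchInᵢ≢i i₀ j (enum-inj _ _ (trans eq (sym enum-i₀)))
  ; enum-inj  = λ i j eq → punchIn-injective i₀ i j (enum-inj _ _ eq)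
  ; enum-surj = λ { a (Pa , a≢a₀) →
      let (i , enum-i) = enum-surj a Pa
          i₀≢i = λ i₀≡i → a≢a₀ (trans (sym enum-i) (trans (cong enum (sym i₀≡i)) enum-i₀))
      in punchOut i₀≢i , trans (cong enum (punchIn-punchOut i₀≢i)) enum-i }
  }
  where
  open HasCard card

  i₀ : Fin (suc K)
  i₀ = proj₁ (enum-surj a₀ Pa₀)

  enum-i₀ : enum i₀ ≡ a₀
  enum-i₀ = proj₂ (enum-surj a₀ Pa₀)

InE-card : ∀ n r → HasCard _≡_ (InE (uvec r n)) (suc n ^ r)
InE-card n r =
  HasCard-image (^↔Vec ↔-refl r) (map toℕ)
    toℕs-≤ᵥ (λ _ _ → map-injective toℕ-injective) (λ _ → fromℕs)
  where
  toℕs-≤ᵥ : ∀ {k} (v : Vec (Fin (suc n)) k) → map toℕ v ≤ᵥ replicate k n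
  toℕs-≤ᵥ []      = []
  toℕs-≤ᵥ (i ∷ v) = toℕ≤pred[n] i ∷ toℕs-≤ᵥ v

  fromℕs : ∀ {k} {x : Vec ℕ k} → x ≤ᵥ replicate k n → ∃ λ v → map toℕ v ≡ x
  fromℕs []            = [] , refl
  fromℕs (a≤n ∷ x≤u) =
    fromℕ< (s≤s a≤n) ∷ proj₁ (fromℕs x≤u) , cong₂ _∷_ (toℕ-fromℕ< _) (proj₂ (fromℕs x≤u))

selectMatrix-card : ∀ {n r} → 1 ≤ n →
                    HasCard {Matrix r} _≡_ (λ M → (M *ᴹ uvec r n) ≤ᵥ uvec r n) (suc r ^ r)
selectMatrix-card {n} {r} 1≤n =
  HasCard-image (^↔Vec ↔-refl r) (map selectRow)
    selectRows-≤ᵥ (λ _ _ → map-injective selectRow-injective) (λ _ → ≤ᵥ⇒selectRows)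
  where
  selectRows-≤ᵥ : ∀ {k} (cs : Vec (Fin (suc r)) k) →
                  map (λ w → dot w (uvec r n)) (map selectRow cs) ≤ᵥ replicate k n
  selectRows-≤ᵥ []       = []
  selectRows-≤ᵥ (c ∷ cs) = subst (_≤ n) (sym (dot-selectRow c _)) (ext-≤ ≤ᵥ-refl c) ∷ selectRows-≤ᵥ cs

  ≤ᵥ⇒selectRows : ∀ {k} {M : Vec (Vec ℕ r) k} → map (λ w → dot w (uvec r n)) M ≤ᵥ replicate k n →
                  ∃ λ cs → map selectRow cs ≡ M
  ≤ᵥ⇒selectRows {M = []}    []          = [] , refl
  ≤ᵥ⇒selectRows {M = w ∷ M} (w≤ ∷ M≤) =
    proj₁ (dot-replicate≤⇒selectRow 1≤n w w≤) ∷ proj₁ (≤ᵥ⇒selectRows M≤) ,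
    cong₂ _∷_ (proj₂ (dot-replicate≤⇒selectRow 1≤n w w≤)) (proj₂ (≤ᵥ⇒selectRows M≤))

module S1S2Operations (n r : ℕ) (1≤n : 1 ≤ n) where

  u : Vec ℕ r
  u = uvec r n

  K : ℕ
  K = suc n ^ r ∸ 1

  open HasCard (HasCard-remove u ≤ᵥ-refl (InE-card n r))
    renaming (enum to point; enum-P to point-P; enum-inj to point-inj; enum-surj to point-surj)

  -- The j-th row of a code is the selection map of the left translation by point j; the
  -- fallback branch covers a = u and the irrelevant a ∉ E_u.
  operation : Vec (Vec (Fin (suc r)) r) K → BinOp r
  operation code a x with any? (λ j → ≡-dec _≟_ (point j) a)
  ... | yes (j , _) = selectMap (lookup (lookup code j)) x
  ... | no _        = x

  operation-top : ∀ code x → operation code u x ≡ x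
  operation-top code x with any? (λ j → ≡-dec _≟_ (point j) u)
  ... | yes (j , pj≡u) = ⊥-elim (proj₂ (point-P j) pj≡u)
  ... | no _           = refl

  operation-point : ∀ code j x → operation code (point j) x ≡ selectMap (lookup (lookup code j)) x
  operation-point code j x with any? (λ j′ → ≡-dec _≟_ (point j′) (point j))
  ... | yes (j′ , pj′≡pj) = cong (λ i → selectMap (lookup (lookup code i)) x) (point-inj j′ j pj′≡pj)
  ... | no ¬∃             = ⊥-elim (¬∃ (j , refl))

  top-or-point : ∀ a → InE u a → a ≡ u ⊎ ∃ λ j → point j ≡ a
  top-or-point a a≤u with ≡-dec _≟_ a u
  ... | yes a≡u = inj₁ a≡u
  ... | no  a≢u = inj₂ (point-surj a (a≤u , a≢u))

  translation-selects : ∀ code a → InE u a → ∃ λ φ → ∀ x → operation code a x ≡ selectMap φ x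
  translation-selects code a a≤u with top-or-point a a≤u
  ... | inj₁ refl       = suc , λ x → trans (operation-top code x) (sym (tabulate∘lookup x))
  ... | inj₂ (j , refl) = lookup (lookup code j) , operation-point code j

  operation-S1S2 : ∀ code → IsS1S2 u (operation code)
  operation-S1S2 code = (λ a x a≤u → proj₁ (S1 a a≤u) x) , S1 , (λ a _ → operation-top code a)
    where
    S1 : ∀ a → InE u a → IsAdditiveSelfMap u (operation code a)
    S1 a a≤u = IsAdditiveSelfMap-resp (proj₂ (translation-selects code a a≤u))
                                      (selectMap-isAdditive (proj₁ (translation-selects code a a≤u)))

  operation-injective : ∀ code code′ → SameOp u (operation code) (operation code′) → code ≡ code′
  operation-injective code code′ same =
    ≡-from-lookup λ j → ≡-from-lookup (selectMap-injective 1≤n λ x x≤u → begin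
      selectMap (lookup (lookup code j)) x   ≡⟨ sym (operation-point code j x) ⟩
      operation code (point j) x             ≡⟨ same (point j) x (proj₁ (point-P j)) x≤u ⟩
      operation code′ (point j) x            ≡⟨ operation-point code′ j x ⟩
      selectMap (lookup (lookup code′ j)) x  ∎)

  operation-surjective : ∀ op → IsS1S2 u op → ∃ λ code → SameOp u (operation code) op
  operation-surjective op (_ , S1 , S2) = code , same
    where
    translation : ∀ j → ∃ λ φ → ∀ x → InE u x → op (point j) x ≡ selectMap φ x
    translation j = additive⇒selectMap 1≤n (S1 (point j) (proj₁ (point-P j)))

    code : Vec (Vec (Fin (suc r)) r) K
    code = tabulate (λ j → tabulate (proj₁ (translation j)))

    lookup-code : ∀ j i → lookup (lookup code j) i ≡ proj₁ (translation j) i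
    lookup-code j i = trans (cong (λ v → lookup v i) (lookup∘tabulate _ j)) (lookup∘tabulate _ i)

    same : SameOp u (operation code) op
    same a x a≤u x≤u with top-or-point a a≤u
    ... | inj₁ refl       = trans (operation-top code x) (sym (S2 x x≤u))
    ... | inj₂ (j , refl) = begin
      operation code (point j) x            ≡⟨ operation-point code j x ⟩
      selectMap (lookup (lookup code j)) x  ≡⟨ selectMap-cong (lookup-code j) x ⟩
      selectMap (proj₁ (translation j)) x   ≡⟨ sym (proj₂ (translation j) x x≤u) ⟩
      op (point j) x                        ∎

  S1S2-card : HasCard (SameOp u) (IsS1S2 u) ((suc r ^ r) ^ K)
  S1S2-card = HasCard-image (^↔Vec (^↔Vec ↔-refl r) K) operation
                operation-S1S2 operation-injective operation-surjective

corollary5p6 : (n r : ℕ) → 1 ≤ n → 1 ≤ r →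
    ((∀ (φ : Fin r → Fin (suc r)) → IsAdditiveSelfMap (uvec r n) (selectMap φ)) ×
     (∀ (L : Vec ℕ r → Vec ℕ r) → IsAdditiveSelfMap (uvec r n) L →
        ∃ λ (φ : Fin r → Fin (suc r)) → ∀ x → InE (uvec r n) x → L x ≡ selectMap φ x)) ×
    HasCard {Matrix r} _≡_ (λ M → (M *ᴹ uvec r n) ≤ᵥ uvec r n) ((suc r) ^ r) ×
    HasCard {BinOp r} (SameOp (uvec r n)) (IsS1S2 (uvec r n)) (((suc r) ^ r) ^ ((suc n) ^ r ∸ 1))
corollary5p6 n r 1≤n _ =
  (selectMap-isAdditive , λ _ → additive⇒selectMap 1≤n) ,
  selectMatrix-card 1≤n ,
  S1S2Operations.S1S2-card n r 1≤n
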